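{- Let $G$ be a graph and $k,s,d^-,d^+$ positive integers. For $i=1,\dots,k$ suppose that $(X_i,W_i)$ is an $(s,d^-,d^+)$-linked system in $G$, with $(X_i\cup W_i)\cap(X_j\cup W_j)=\emptyset$ for $i\neq j$. Suppose that $F$ is a connected graph with vertex set $\{1,\dots,k\}$ such that for every edge $uv\in E(F)$ there is a family $\mathcal P_{uv}$ of $t$ vertex-disjoint paths, each of length at most $3$, each going from a vertex of $X_u$ to a vertex of $X_v$, with interior vertices outside $\bigcup_{i=1}^k(X_i\cup W_i)$, where $t\geq 15ks$. Then $(X,W)$ is an $(s,k(d^-+3),d^+)$-linked system, where $X=X_1\cup\dots\cup X_k$ and $W=W_1\cup\dots\cup W_k\cup\bigcup_{e\in E(F)}\bigcup_{P\in\mathcal P_e}V(P)$.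
   Context: For sets $X,W$ of vertices in a graph, $(X,W)$ is an $(s,d^-,d^+)$-linked system if for any distinct vertices $x_1,y_1,\dots,x_s,y_s\in X$ and any integers $d_1,\dots,d_s$ with $d^-\leq d_i\leq d^+$, there are vertex-disjoint paths $P_1,\dots,P_s$ such that $P_i$ goes from $x_i$ to $y_i$, has all interior vertices in $W$, and has length (number of edges) $d_i$. -}

module Defs where

open import Data.Nat using (ℕ; zero; suc; _≤_; _<_; _*_)
open import Data.Fin using (Fin; toℕ; fromℕ; inject₁) renaming (zero to fzero; suc to fsuc)
open import Data.Fin as F using ()
open import Data.Bool using (Bool; true; false; T)
open import Data.Sum using (_⊎_; [_,_])
open import Data.Product using (Σ; ∃; _×_; _,_)
open import Data.Empty using (⊥)
open import Relation.Binary.PropositionalEquality using (_≡_; _≢_)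
open import Function.Definitions using (Injective)

record Graph (n : ℕ) : Set where
  field
    adj    : Fin n → Fin n → Bool
    sym    : ∀ u v → adj u v ≡ adj v u
    irrefl : ∀ v → adj v v ≡ false

  Adj : Fin n → Fin n → Set
  Adj u v = T (adj u v)

open Graph public

VSet : ℕ → Set₁
VSet n = Fin n → Set

record Path {n : ℕ} (G : Graph n) (x y : Fin n) (d : ℕ) : Set where
  field
    vert  : Fin (suc d) → Fin n
    inj   : Injective _≡_ _≡_ vert
    start : vert fzero ≡ x
    end   : vert (fromℕ d) ≡ y
    step  : ∀ (i : Fin d) → Adj G (vert (inject₁ i)) (vert (fsuc i))

open Path public

OnPath : ∀ {n} {G : Graph n} {x y d} → Path G x y d → Fin n → Set
OnPath {d = d} P v = Σ (Fin (suc d)) λ i → vert P i ≡ v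

Interior : ∀ {n} {G : Graph n} {x y d} → Path G x y d → Fin n → Set
Interior {d = d} P v =
  Σ (Fin (suc d)) λ i → (0 < toℕ i) × (toℕ i < d) × (vert P i ≡ v)

InteriorIn : ∀ {n} {G : Graph n} {x y d} → Path G x y d → VSet n → Set
InteriorIn P W = ∀ v → Interior P v → W v

Disjoint : ∀ {n} {G : Graph n} {x y d x' y' d'} →
           Path G x y d → Path G x' y' d' → Set
Disjoint P Q = ∀ v → OnPath P v → OnPath Q v → ⊥

-- (X , W) is an (s, d⁻, d⁺)-linked system in G.
-- Distinctness of x₁,y₁,…,xₛ,yₛ: the combined map Fin s ⊎ Fin s → V is injective.
LinkedSystem : ∀ {n} → Graph n → (s dm dp : ℕ) → VSet n → VSet n → Set
LinkedSystem G s dm dp X W =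
  (xs ys : Fin s → _) →
  (∀ i → X (xs i)) → (∀ i → X (ys i)) →
  Injective _≡_ _≡_ [ xs , ys ] →
  (ds : Fin s → ℕ) → (∀ i → dm ≤ ds i × ds i ≤ dp) →
  Σ ((i : Fin s) → Path G (xs i) (ys i) (ds i)) λ P →
    (∀ i → InteriorIn (P i) W) × (∀ i j → i ≢ j → Disjoint (P i) (P j))

Connected : ∀ {n} → Graph n → Set
Connected {n} G = ∀ (u v : Fin n) → ∃ λ d → Path G u v d

record ShortLink {n : ℕ} (G : Graph n) (A B : VSet n) : Set where
  field
    src   : Fin n
    tgt   : Fin n
    len   : ℕ
    srcIn : A src
    tgtIn : B tgt
    len≤3 : len ≤ 3
    path  : Path G src tgt len

open ShortLink public

OnLink : ∀ {n} {G : Graph n} {A B} → ShortLink G A B → Fin n → Set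
OnLink L v = OnPath (path L) v

LinkInteriorIn : ∀ {n} {G : Graph n} {A B} → ShortLink G A B → VSet n → Set
LinkInteriorIn L W = InteriorIn (path L) W

LinkDisjoint : ∀ {n} {G : Graph n} {A B} → ShortLink G A B → ShortLink G A B → Set
LinkDisjoint L L' = Disjoint (path L) (path L')

⋃ : ∀ {n k} → (Fin k → VSet n) → VSet n
⋃ {k = k} S v = Σ (Fin k) λ i → S i v

-- Each pair (x, y) is routed along a path of F from the piece containing x to the piece
-- containing y.  In every piece on the route it follows a path of that piece's linked system,
-- and consecutive pieces are joined by one of the t short links of the corresponding edge.  The
-- links are chosen greedily: at most 3ks are needed (one per route edge, plus two spare links
-- per pair and piece, whose sources serve as dummy endpoints where a route does not pass, since
-- every piece must link exactly s pairs), each has at most 4 vertices, and together with the 2s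
-- prescribed endpoints they block fewer than 15ks ≤ t candidates.  All pieces of a route but the
-- first get length d⁻, and the first absorbs the rest of the required length; this is possible
-- because a route visits at most k pieces and every link has length at most 3.

module Submission where

open import Defs
open import Data.Nat as ℕ using (ℕ; zero; suc; _+_; _*_; _∸_; _≤_; z≤n; s≤s)
open import Data.Nat.Properties as ℕ using ()
open import Data.Nat.Tactic.RingSolver using (solve-∀)
open import Data.Fin using (Fin; _<_; toℕ; fromℕ; fromℕ<; inject₁; inject≤; lower₁; opposite; combine; remQuot; _≟_)
  renaming (zero to fzero; suc to fsuc)
open import Data.Fin.Properties as Fin using (toℕ-injective; toℕ-fromℕ; toℕ<n; <-cmp; pigeonhole; all?; ¬∀⟶∃¬)
open import Algebra.Properties.Monoid.Sum ℕ.+-0-monoid using (sum-syntax)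
open import Data.List using (List)
open import Data.List.Relation.Binary.Disjoint.Propositional using () renaming (Disjoint to Disjointᴸ)
open import Data.Sum using (_⊎_; inj₁; inj₂; [_,_]; [_,_]′)
open import Data.Sum.Properties using ([,]-∘)
open import Data.Product using (Σ; _×_; _,_; proj₁; proj₂)
open import Data.Product.Properties using (≡-dec)
open import Data.Empty using (⊥; ⊥-elim)
open import Data.Unit using (⊤; tt)
open import Data.Bool using (T)
open import Relation.Nullary using (¬_; yes; no)
open import Relation.Binary.Definitions using (DecidableEquality; tri<; tri≈; tri>)
open import Relation.Binary.PropositionalEquality as ≡ using (_≡_; _≢_; refl; trans; cong; subst; subst₂)
open import Function.Base using (_∘_)
open import Function.Definitions using (Injective)

Adj-sym : ∀ {k} (F : Graph k) {u v} → Adj F u v → Adj F v u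
Adj-sym F {u} {v} = subst T (Graph.sym F u v)

module _ {n : ℕ} {G : Graph n} {x y : Fin n} {d : ℕ} (P : Path G x y d) where

  start∈ : OnPath P x
  start∈ = fzero , start P

  end∈ : OnPath P y
  end∈ = fromℕ d , end P

  interior⇒onPath : ∀ {v} → Interior P v → OnPath P v
  interior⇒onPath (i , _ , _ , e) = i , e

  interior-≢start : ∀ {v} → Interior P v → v ≢ x
  interior-≢start (i , 0<i , _ , e) refl with inj P (trans e (≡.sym (start P)))
  ... | refl = ℕ.<-irrefl refl 0<i

  interior-≢end : ∀ {v} → Interior P v → v ≢ y
  interior-≢end (i , _ , i<d , e) refl with inj P (trans e (≡.sym (end P)))
  ... | refl = ℕ.<-irrefl (toℕ-fromℕ d) i<d

  onPath⇒interior : ∀ {v} → OnPath P v → v ≢ x → v ≢ y → Interior P v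
  onPath⇒interior {v} (i , e) v≢x v≢y = i , 0<i i e , i<d , e
    where
      0<i : ∀ j → vert P j ≡ v → 0 ℕ.< toℕ j
      0<i fzero    e′ = ⊥-elim (v≢x (trans (≡.sym e′) (start P)))
      0<i (fsuc j) e′ = s≤s z≤n
      i<d : toℕ i ℕ.< d
      i<d = ℕ.≤∧≢⇒< (ℕ.≤-pred (toℕ<n i)) λ i≡d →
        v≢y (trans (≡.sym e) (trans (cong (vert P) (toℕ-injective (trans i≡d (≡.sym (toℕ-fromℕ d))))) (end P)))

  endpoint⊎interior : ∀ {v} → OnPath P v → v ≡ x ⊎ v ≡ y ⊎ Interior P v
  endpoint⊎interior {v} v∈P with v ≟ x | v ≟ y
  ... | yes v≡x | _       = inj₁ v≡x
  ... | no _    | yes v≡y = inj₂ (inj₁ v≡y)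
  ... | no v≢x  | no v≢y  = inj₂ (inj₂ (onPath⇒interior v∈P v≢x v≢y))

module _ {n : ℕ} {G : Graph n} where

  private
    opposite-inject₁ : ∀ {d} (i : Fin d) → opposite {suc d} (inject₁ i) ≡ fsuc (opposite i)
    opposite-inject₁ {suc d} fzero    = refl
    opposite-inject₁ {suc d} (fsuc i) = cong inject₁ (opposite-inject₁ i)

    opposite-fromℕ : ∀ d → opposite (fromℕ d) ≡ fzero
    opposite-fromℕ zero    = refl
    opposite-fromℕ (suc d) = cong inject₁ (opposite-fromℕ d)

  reverse : ∀ {x y d} → Path G x y d → Path G y x d
  reverse {d = d} P = record
    { vert  = vert P ∘ opposite
    ; inj   = λ {i} {j} e →
        trans (≡.sym (Fin.opposite-involutive i)) (trans (cong opposite (inj P e)) (Fin.opposite-involutive j))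
    ; start = end P
    ; end   = trans (cong (vert P) (opposite-fromℕ d)) (start P)
    ; step  = λ i → subst (λ j → Adj G (vert P j) (vert P (opposite (fsuc i))))
                          (≡.sym (opposite-inject₁ i)) (Adj-sym G (step P (opposite i)))
    }

  onPath-reverse⁻ : ∀ {x y d v} (P : Path G x y d) → OnPath (reverse P) v → OnPath P v
  onPath-reverse⁻ P (i , e) = opposite i , e

  interior-reverse⁻ : ∀ {x y d v} (P : Path G x y d) → Interior (reverse P) v → Interior P v
  interior-reverse⁻ P v∈P° =
    onPath⇒interior P (onPath-reverse⁻ P (interior⇒onPath (reverse P) v∈P°))
      (interior-≢end (reverse P) v∈P°) (interior-≢start (reverse P) v∈P°)

  cast : ∀ {x y d x′ y′ d′} → x ≡ x′ → y ≡ y′ → d ≡ d′ → Path G x y d → Path G x′ y′ d′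
  cast refl refl refl P = P

  onPath-cast⁻ : ∀ {x y d x′ y′ d′ v} (x≡ : x ≡ x′) (y≡ : y ≡ y′) (d≡ : d ≡ d′) (P : Path G x y d) →
                 OnPath (cast x≡ y≡ d≡ P) v → OnPath P v
  onPath-cast⁻ refl refl refl P v∈P = v∈P

  interior-cast⁻ : ∀ {x y d x′ y′ d′ v} (x≡ : x ≡ x′) (y≡ : y ≡ y′) (d≡ : d ≡ d′) (P : Path G x y d) →
                   Interior (cast x≡ y≡ d≡ P) v → Interior P v
  interior-cast⁻ refl refl refl P v∈P° = v∈P°

  private
    open import Data.Vec using (Vec; []; _∷_; _++_; lookup; tabulate)
    open import Data.Vec.Properties using (lookup∘tabulate)
    open import Data.Vec.Membership.Propositional using (_∈_; _∉_)
    open import Data.Vec.Membership.Propositional.Properties using (∈-lookup)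
    open import Data.Vec.Relation.Unary.Any using (here; there; index)
    open import Data.Vec.Relation.Unary.Any.Properties using (lookup-index; ++⁻)

    V : Set
    V = Fin n

    lastVertex : ∀ {m} → V → Vec V m → V
    lastVertex x []       = x
    lastVertex x (v ∷ vs) = lastVertex v vs

    Walk : ∀ {m} → V → Vec V m → Set
    Walk x []       = ⊤
    Walk x (v ∷ vs) = Adj G x v × Walk v vs

    Distinct : ∀ {m} → Vec V m → Set
    Distinct []       = ⊤
    Distinct (v ∷ vs) = v ∉ vs × Distinct vs

    -- A path stored as the vertex list x ∷ rest, which makes concatenation a list append.
    record Trail (x y : V) (d : ℕ) : Set where
      field
        rest     : Vec V d
        ends     : lastVertex x rest ≡ y
        walk     : Walk x rest
        distinct : Distinct (x ∷ rest)
    open Trail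

    lastVertex-++ : ∀ {a b} x (vs : Vec V a) (ws : Vec V b) →
                  lastVertex x (vs ++ ws) ≡ lastVertex (lastVertex x vs) ws
    lastVertex-++ x []       ws = refl
    lastVertex-++ x (v ∷ vs) ws = lastVertex-++ v vs ws

    walk-++ : ∀ {a b} x (vs : Vec V a) (ws : Vec V b) →
              Walk x vs → Walk (lastVertex x vs) ws → Walk x (vs ++ ws)
    walk-++ x []       ws _         w′ = w′
    walk-++ x (v ∷ vs) ws (xv , w) w′ = xv , walk-++ v vs ws w w′

    distinct-++ : ∀ {a b} (vs : Vec V a) (ws : Vec V b) → Distinct vs → Distinct ws →
                  (∀ {v} → v ∈ vs → v ∈ ws → ⊥) → Distinct (vs ++ ws)
    distinct-++ []       ws _          dw _    = dw
    distinct-++ (v ∷ vs) ws (v∉vs , dv) dw apart =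
      [ v∉vs , apart (here refl) ] ∘ ++⁻ vs , distinct-++ vs ws dv dw (apart ∘ there)

    join : ∀ {x y z d e} (P : Trail x y d) (Q : Trail y z e) →
           (∀ {v} → v ∈ x ∷ rest P → v ∈ y ∷ rest Q → v ≡ y) → Trail x z (d + e)
    join {x} {y} P Q meet = record
      { rest     = rest P ++ rest Q
      ; ends     = trans (lastVertex-++ x (rest P) (rest Q))
                         (trans (cong (λ w → lastVertex w (rest Q)) (ends P)) (ends Q))
      ; walk     = walk-++ x (rest P) (rest Q) (walk P)
                     (subst (λ w → Walk w (rest Q)) (≡.sym (ends P)) (walk Q))
      ; distinct = [ proj₁ (distinct P) , (λ p → y∉Q p (meet (here refl) (there p))) ]′ ∘ ++⁻ (rest P)
                 , distinct-++ (rest P) (rest Q) (proj₂ (distinct P)) (proj₂ (distinct Q))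
                     (λ v∈P v∈Q → y∉Q v∈Q (meet (there v∈P) (there v∈Q)))
      }
      where
        y∉Q : ∀ {v} → v ∈ rest Q → v ≡ y → ⊥
        y∉Q v∈Q refl = proj₁ (distinct Q) v∈Q

    ∈-join⁻ : ∀ {x y z d e v} (P : Trail x y d) (Q : Trail y z e) →
              v ∈ x ∷ (rest P ++ rest Q) → v ∈ x ∷ rest P ⊎ v ∈ y ∷ rest Q
    ∈-join⁻ P Q (here e)  = inj₁ (here e)
    ∈-join⁻ P Q (there p) = [ inj₁ ∘ there , inj₂ ∘ there ]′ (++⁻ (rest P) p)

    lookup-injective : ∀ {m} (vs : Vec V m) → Distinct vs → ∀ {i j} → lookup vs i ≡ lookup vs j → i ≡ j
    lookup-injective (v ∷ vs) _          {fzero}  {fzero}  _ = refl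
    lookup-injective (v ∷ vs) (v∉vs , _) {fzero}  {fsuc j} e = ⊥-elim (v∉vs (subst (_∈ vs) (≡.sym e) (∈-lookup j vs)))
    lookup-injective (v ∷ vs) (v∉vs , _) {fsuc i} {fzero}  e = ⊥-elim (v∉vs (subst (_∈ vs) e (∈-lookup i vs)))
    lookup-injective (v ∷ vs) (_ , dvs)  {fsuc i} {fsuc j} e = cong fsuc (lookup-injective vs dvs e)

    lookup-fromℕ : ∀ {m} x (vs : Vec V m) → lookup (x ∷ vs) (fromℕ m) ≡ lastVertex x vs
    lookup-fromℕ x []       = refl
    lookup-fromℕ x (v ∷ vs) = lookup-fromℕ v vs

    lookup-step : ∀ {m} x (vs : Vec V m) → Walk x vs →
                  ∀ i → Adj G (lookup (x ∷ vs) (inject₁ i)) (lookup (x ∷ vs) (fsuc i))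
    lookup-step x (v ∷ vs) (xv , _) fzero    = xv
    lookup-step x (v ∷ vs) (_  , w) (fsuc i) = lookup-step v vs w i

    toPath : ∀ {x y d} → Trail x y d → Path G x y d
    toPath {x} P = record
      { vert  = lookup (x ∷ rest P)
      ; inj   = lookup-injective (x ∷ rest P) (distinct P)
      ; start = refl
      ; end   = trans (lookup-fromℕ x (rest P)) (ends P)
      ; step  = lookup-step x (rest P) (walk P)
      }

    onPath-toPath⁻ : ∀ {x y d v} (P : Trail x y d) → OnPath (toPath P) v → v ∈ x ∷ rest P
    onPath-toPath⁻ {x} P (i , refl) = ∈-lookup i (x ∷ rest P)

    ∈-tabulate⁻ : ∀ {m v} (f : Fin m → V) → v ∈ tabulate f → Σ (Fin m) λ i → f i ≡ v
    ∈-tabulate⁻ f p = index p , ≡.sym (trans (lookup-index p) (lookup∘tabulate f (index p)))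

    lastVertex-tabulate : ∀ {m} (f : Fin (suc m) → V) → lastVertex (f fzero) (tabulate (f ∘ fsuc)) ≡ f (fromℕ m)
    lastVertex-tabulate {zero}  f = refl
    lastVertex-tabulate {suc m} f = lastVertex-tabulate (f ∘ fsuc)

    walk-tabulate : ∀ {m} (f : Fin (suc m) → V) → (∀ i → Adj G (f (inject₁ i)) (f (fsuc i))) →
                    Walk (f fzero) (tabulate (f ∘ fsuc))
    walk-tabulate {zero}  f adj = tt
    walk-tabulate {suc m} f adj = adj fzero , walk-tabulate (f ∘ fsuc) (adj ∘ fsuc)

    distinct-tabulate : ∀ {m} (f : Fin m → V) → Injective _≡_ _≡_ f → Distinct (tabulate f)
    distinct-tabulate {zero}  f f-inj = tt
    distinct-tabulate {suc m} f f-inj =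
      (λ p → 0≢suc (f-inj (proj₂ (∈-tabulate⁻ (f ∘ fsuc) p))))
      , distinct-tabulate (f ∘ fsuc) (Fin.suc-injective ∘ f-inj)
      where
        0≢suc : ∀ {i : Fin m} → fsuc i ≢ fzero
        0≢suc ()

    trailOf : ∀ {x y d} (f : Fin (suc d) → V) → Injective _≡_ _≡_ f → f fzero ≡ x → f (fromℕ d) ≡ y →
              (∀ i → Adj G (f (inject₁ i)) (f (fsuc i))) → Trail x y d
    trailOf f f-inj refl refl adj = record
      { rest = tabulate (f ∘ fsuc) ; ends = lastVertex-tabulate f
      ; walk = walk-tabulate f adj ; distinct = distinct-tabulate f f-inj }

    ∈-trailOf⁻ : ∀ {x y d v} (f : Fin (suc d) → V) (f-inj : Injective _≡_ _≡_ f)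
                 (x≡ : f fzero ≡ x) (y≡ : f (fromℕ d) ≡ y) (adj : ∀ i → Adj G (f (inject₁ i)) (f (fsuc i))) →
                 v ∈ x ∷ rest (trailOf f f-inj x≡ y≡ adj) → Σ (Fin (suc d)) λ i → f i ≡ v
    ∈-trailOf⁻ f f-inj refl refl adj = ∈-tabulate⁻ f

    fromPath : ∀ {x y d} → Path G x y d → Trail x y d
    fromPath P = trailOf (vert P) (inj P) (start P) (end P) (step P)

    ∈-fromPath⁻ : ∀ {x y d v} (P : Path G x y d) → v ∈ x ∷ rest (fromPath P) → OnPath P v
    ∈-fromPath⁻ P = ∈-trailOf⁻ (vert P) (inj P) (start P) (end P) (step P)

  private
    joinPaths : ∀ {x y z d e} (P : Path G x y d) (Q : Path G y z e) →
                (∀ {v} → OnPath P v → OnPath Q v → v ≡ y) → Trail x z (d + e)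
    joinPaths P Q meet = join (fromPath P) (fromPath Q) λ v∈P v∈Q → meet (∈-fromPath⁻ P v∈P) (∈-fromPath⁻ Q v∈Q)

  concat : ∀ {x y z d e} (P : Path G x y d) (Q : Path G y z e) →
           (∀ {v} → OnPath P v → OnPath Q v → v ≡ y) → Path G x z (d + e)
  concat P Q meet = toPath (joinPaths P Q meet)

  onPath-concat⁻ : ∀ {x y z d e v} (P : Path G x y d) (Q : Path G y z e)
                   (meet : ∀ {w} → OnPath P w → OnPath Q w → w ≡ y) →
                   OnPath (concat P Q meet) v → OnPath P v ⊎ OnPath Q v
  onPath-concat⁻ P Q meet v∈PQ =
    [ inj₁ ∘ ∈-fromPath⁻ P , inj₂ ∘ ∈-fromPath⁻ Q ]′
      (∈-join⁻ (fromPath P) (fromPath Q) (onPath-toPath⁻ (joinPaths P Q meet) v∈PQ))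

module _ {n : ℕ} {G : Graph n} where

  record Chain (L : ℕ) : Set where
    field
      entry exit    : Fin (suc L) → Fin n
      segmentLength : Fin (suc L) → ℕ
      linkLength    : Fin L → ℕ
      segment       : ∀ q → Path G (entry q) (exit q) (segmentLength q)
      link          : ∀ e → Path G (exit (inject₁ e)) (entry (fsuc e)) (linkLength e)
      segments-disjoint : ∀ {q q′} → q ≢ q′ → Disjoint (segment q) (segment q′)
      links-disjoint    : ∀ {e e′} → e ≢ e′ → Disjoint (link e) (link e′)
      link-avoids-segments : ∀ e q {v} → Interior (link e) v → OnPath (segment q) v → ⊥

  open Chain

  private
    tail : ∀ {L} → Chain (suc L) → Chain L
    tail C = record
      { entry = entry C ∘ fsuc ; exit = exit C ∘ fsuc
      ; segmentLength = segmentLength C ∘ fsuc ; linkLength = linkLength C ∘ fsuc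
      ; segment = segment C ∘ fsuc ; link = link C ∘ fsuc
      ; segments-disjoint = λ q≢q′ → segments-disjoint C (q≢q′ ∘ Fin.suc-injective)
      ; links-disjoint = λ e≢e′ → links-disjoint C (e≢e′ ∘ Fin.suc-injective)
      ; link-avoids-segments = λ e q → link-avoids-segments C (fsuc e) (fsuc q)
      }

  chainLength : ∀ {L} → Chain L → ℕ
  chainLength {zero}  C = segmentLength C fzero
  chainLength {suc L} C = segmentLength C fzero + (linkLength C fzero + chainLength (tail C))

  Covered : ∀ {L} → Chain L → Fin n → Set
  Covered {L} C v = (Σ (Fin (suc L)) λ q → OnPath (segment C q) v) ⊎ (Σ (Fin L) λ e → Interior (link C e) v)

  private
    module _ {L d} (C : Chain (suc L)) (R : Path G (entry C (fsuc fzero)) (exit C (fromℕ (suc L))) d)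
             (R-covered : ∀ {v} → OnPath R v → Covered (tail C) v) where

      fzero≢fsuc : ∀ {m} {i : Fin m} → fzero ≢ fsuc i
      fzero≢fsuc ()

      link-meets-rest : ∀ {v} → OnPath (link C fzero) v → OnPath R v → v ≡ entry C (fsuc fzero)
      link-meets-rest {v} v∈link v∈R with R-covered v∈R
      ... | inj₂ (e , v∈link°) =
        ⊥-elim (links-disjoint C fzero≢fsuc v v∈link (interior⇒onPath (link C (fsuc e)) v∈link°))
      ... | inj₁ (q , v∈seg) with endpoint⊎interior (link C fzero) v∈link
      ...   | inj₁ refl = ⊥-elim (segments-disjoint C fzero≢fsuc v (end∈ (segment C fzero)) v∈seg)
      ...   | inj₂ (inj₁ v≡entry) = v≡entry
      ...   | inj₂ (inj₂ v∈link°) = ⊥-elim (link-avoids-segments C fzero (fsuc q) v∈link° v∈seg)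

      linkThenRest : Path G (exit C fzero) (exit C (fromℕ (suc L))) (linkLength C fzero + d)
      linkThenRest = concat (link C fzero) R link-meets-rest

      segment-meets-rest : ∀ {v} → OnPath (segment C fzero) v → OnPath linkThenRest v → v ≡ exit C fzero
      segment-meets-rest {v} v∈seg v∈rest with onPath-concat⁻ (link C fzero) R link-meets-rest v∈rest
      ... | inj₂ v∈R with R-covered v∈R
      ...   | inj₁ (q , v∈seg′) = ⊥-elim (segments-disjoint C fzero≢fsuc v v∈seg v∈seg′)
      ...   | inj₂ (e , v∈link°) = ⊥-elim (link-avoids-segments C (fsuc e) fzero v∈link° v∈seg)
      segment-meets-rest {v} v∈seg v∈rest | inj₁ v∈link with endpoint⊎interior (link C fzero) v∈link
      ...   | inj₁ v≡exit = v≡exit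
      ...   | inj₂ (inj₁ refl) = ⊥-elim (segments-disjoint C fzero≢fsuc v v∈seg (start∈ (segment C (fsuc fzero))))
      ...   | inj₂ (inj₂ v∈link°) = ⊥-elim (link-avoids-segments C fzero fzero v∈link° v∈seg)

      extend : Path G (entry C fzero) (exit C (fromℕ (suc L))) (segmentLength C fzero + (linkLength C fzero + d))
      extend = concat (segment C fzero) linkThenRest segment-meets-rest

      extend-covered : ∀ {v} → OnPath extend v → Covered C v
      extend-covered v∈P with onPath-concat⁻ (segment C fzero) linkThenRest segment-meets-rest v∈P
      ... | inj₁ v∈seg = inj₁ (fzero , v∈seg)
      ... | inj₂ v∈rest with onPath-concat⁻ (link C fzero) R link-meets-rest v∈rest
      ...   | inj₂ v∈R with R-covered v∈R
      ...     | inj₁ (q , v∈seg) = inj₁ (fsuc q , v∈seg)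
      ...     | inj₂ (e , v∈link°) = inj₂ (fsuc e , v∈link°)
      extend-covered v∈P | inj₂ v∈rest | inj₁ v∈link with endpoint⊎interior (link C fzero) v∈link
      ...     | inj₁ refl = inj₁ (fzero , end∈ (segment C fzero))
      ...     | inj₂ (inj₁ refl) = inj₁ (fsuc fzero , start∈ (segment C (fsuc fzero)))
      ...     | inj₂ (inj₂ v∈link°) = inj₂ (fzero , v∈link°)

  mutual
    glue : ∀ {L} (C : Chain L) → Path G (entry C fzero) (exit C (fromℕ L)) (chainLength C)
    glue {zero}  C = segment C fzero
    glue {suc L} C = extend C (glue (tail C)) (glue-covered (tail C))

    glue-covered : ∀ {L} (C : Chain L) {v} → OnPath (glue C) v → Covered C v
    glue-covered {zero}  C v∈P = inj₁ (fzero , v∈P)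
    glue-covered {suc L} C v∈P = extend-covered C (glue (tail C)) (glue-covered (tail C)) v∈P

  chainLength-sum : ∀ {L} (C : Chain L) →
    chainLength C ≡ segmentLength C fzero + ∑[ e < L ] (linkLength C e + segmentLength C (fsuc e))
  chainLength-sum {zero}  C = ≡.sym (ℕ.+-identityʳ _)
  chainLength-sum {suc L} C = cong (segmentLength C fzero +_) (trans
    (cong (linkLength C fzero +_) (chainLength-sum (tail C)))
    (≡.sym (ℕ.+-assoc (linkLength C fzero) (segmentLength C (fsuc fzero)) _)))

module _ {A : Set} (_≟_ : DecidableEquality A) where

  open import Data.List using (_++_; length; lookup)
  open import Data.List.Properties using (length-++)
  open import Data.List.Relation.Unary.Any as Any using (any?)
  open import Data.List.Relation.Unary.Any.Properties using (lookup-index)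
  open import Data.List.Membership.Propositional using (_∈_; find; lose)
  open import Data.List.Membership.Propositional.Properties using (∈-++⁺ˡ; ∈-++⁺ʳ)
  open import Data.List.Membership.DecPropositional _≟_ using (_∈?_)
  open import Data.Vec.Functional using (_∷_)

  member-avoiding : ∀ {t} (B : List A) (Vs : Fin t → List A) →
                    (∀ {a b} → a ≢ b → Disjointᴸ (Vs a) (Vs b)) → length B ℕ.< t →
                    Σ (Fin t) λ a → Disjointᴸ (Vs a) B
  member-avoiding {t} B Vs Vs-disjoint |B|<t with all? (λ a → any? (_∈? B) (Vs a))
  ... | no ¬all = let a , ¬meets = ¬∀⟶∃¬ t _ (λ a → any? (_∈? B) (Vs a)) ¬all
                  in a , λ (v∈Vs , v∈B) → ¬meets (lose v∈Vs v∈B)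
  -- Otherwise sending each list to the position in B of a common element would be injective.
  ... | yes all-meet = ⊥-elim (clash (pigeonhole |B|<t position))
    where
      common : Fin t → A
      common a = proj₁ (find (all-meet a))
      common∈Vs : ∀ a → common a ∈ Vs a
      common∈Vs a = proj₁ (proj₂ (find (all-meet a)))
      common∈B : ∀ a → common a ∈ B
      common∈B a = proj₂ (proj₂ (find (all-meet a)))
      position : Fin t → Fin (length B)
      position a = Any.index (common∈B a)
      clash : (Σ (Fin t) λ i → Σ (Fin t) λ j → i < j × position i ≡ position j) → ⊥
      clash (i , j , i<j , same) = Vs-disjoint (Fin.<⇒≢ i<j) (common∈Vs i , subst (_∈ Vs j) common-eq (common∈Vs j))
        where
          common-eq : common j ≡ common i
          common-eq = trans (lookup-index (common∈B j))
                        (trans (cong (lookup B) (≡.sym same)) (≡.sym (lookup-index (common∈B i))))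

  private
    bound-step : ∀ {t b N} (B V : List A) → length V ≤ b → length B + b * suc N ℕ.< t → length (V ++ B) + b * N ℕ.< t
    bound-step {t} {b} {N} B V |V|≤b bound = ℕ.≤-<-trans (begin
      length (V ++ B) + b * N       ≡⟨ cong (_+ b * N) (length-++ V) ⟩
      length V + length B + b * N   ≤⟨ ℕ.+-monoˡ-≤ (b * N) (ℕ.+-monoˡ-≤ (length B) |V|≤b) ⟩
      b + length B + b * N          ≡⟨ arrange b (length B) N ⟩
      length B + b * suc N          ∎) bound
      where
        open ℕ.≤-Reasoning
        arrange : ∀ b l N → b + l + b * N ≡ l + b * suc N
        arrange = solve-∀

  choice-avoiding : ∀ {t b} (N : ℕ) (B : List A) (Vs : Fin N → Fin t → List A) →
                    (∀ r a → length (Vs r a) ≤ b) →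
                    (∀ r {a a′} → a ≢ a′ → Disjointᴸ (Vs r a) (Vs r a′)) →
                    length B + b * N ℕ.< t →
                    Σ (Fin N → Fin t) λ c → (∀ r → Disjointᴸ (Vs r (c r)) B) ×
                                            (∀ {r r′} → r ≢ r′ → Disjointᴸ (Vs r (c r)) (Vs r′ (c r′)))
  choice-avoiding zero B Vs _ _ _ = (λ ()) , (λ ()) , λ {r} → ⊥-elim (Fin.¬Fin0 r)
  choice-avoiding {t} {b} (suc N) B Vs |Vs|≤b Vs-disjoint bound
    with member-avoiding B (Vs fzero) (Vs-disjoint fzero) (ℕ.≤-<-trans (ℕ.m≤m+n (length B) (b * suc N)) bound)
  ... | a , a-avoids
    with choice-avoiding N (Vs fzero a ++ B) (Vs ∘ fsuc) (|Vs|≤b ∘ fsuc) (Vs-disjoint ∘ fsuc)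
           (bound-step B (Vs fzero a) (|Vs|≤b fzero a) bound)
  ... | c , c-avoids , c-apart = a ∷ c , avoids , apart
    where
      avoids : ∀ r → Disjointᴸ (Vs r ((a ∷ c) r)) B
      avoids fzero                  = a-avoids
      avoids (fsuc r) (v∈Vs , v∈B) = c-avoids r (v∈Vs , ∈-++⁺ʳ _ v∈B)
      apart : ∀ {r r′} → r ≢ r′ → Disjointᴸ (Vs r ((a ∷ c) r)) (Vs r′ ((a ∷ c) r′))
      apart {fzero}  {fzero}   0≢0 = ⊥-elim (0≢0 refl)
      apart {fzero}  {fsuc r′} _ (v∈V₀ , v∈V) = c-avoids r′ (v∈V , ∈-++⁺ˡ v∈V₀)
      apart {fsuc r} {fzero}   _ (v∈V , v∈V₀) = c-avoids r (v∈V , ∈-++⁺ˡ v∈V₀)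
      apart {fsuc r} {fsuc r′} r≢r′ = c-apart (r≢r′ ∘ cong fsuc)

  choice-avoiding-retract : ∀ {I : Set} {t b N} (code : I → Fin N) (decode : Fin N → I) →
                            (∀ x → decode (code x) ≡ x) →
                            (B : List A) (Vs : I → Fin t → List A) →
                            (∀ x a → length (Vs x a) ≤ b) →
                            (∀ x {a a′} → a ≢ a′ → Disjointᴸ (Vs x a) (Vs x a′)) →
                            length B + b * N ℕ.< t →
                            Σ (I → Fin t) λ c → (∀ x → Disjointᴸ (Vs x (c x)) B) ×
                                                (∀ {x y} → x ≢ y → Disjointᴸ (Vs x (c x)) (Vs y (c y)))
  choice-avoiding-retract {N = N} code decode retract B Vs |Vs|≤b Vs-disjoint bound
    with choice-avoiding N B (Vs ∘ decode) (|Vs|≤b ∘ decode) (Vs-disjoint ∘ decode) bound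
  ... | c , c-avoids , c-apart = c ∘ code , avoids , apart
    where
      at : ∀ x → Vs (decode (code x)) (c (code x)) ≡ Vs x (c (code x))
      at x = cong (λ y → Vs y (c (code x))) (retract x)
      avoids : ∀ x → Disjointᴸ (Vs x (c (code x))) B
      avoids x = subst (λ V → Disjointᴸ V B) (at x) (c-avoids (code x))
      apart : ∀ {x y} → x ≢ y → Disjointᴸ (Vs x (c (code x))) (Vs y (c (code y)))
      apart {x} {y} x≢y = subst₂ Disjointᴸ (at x) (at y)
        (c-apart λ same → x≢y (trans (≡.sym (retract x)) (trans (cong decode same) (retract y))))

sum-≤ : ∀ {L c} (f : Fin L → ℕ) → (∀ e → f e ≤ c) → ∑[ e < L ] f e ≤ L * c
sum-≤ {zero}  f f≤c = z≤n
sum-≤ {suc L} f f≤c = ℕ.+-mono-≤ (f≤c fzero) (sum-≤ (f ∘ fsuc) (f≤c ∘ fsuc))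

-- 2s blocked vertices and 3ks links of at most 4 vertices each leave room among 15ks candidates.
slots-fit : ∀ {k s} → 2 ≤ k → 1 ≤ s → s + s + 4 * (s * (k * 3)) ℕ.< 15 * k * s
slots-fit {suc (suc k)} {suc s} (s≤s (s≤s _)) (s≤s _) =
  ℕ.≤-trans (ℕ.m≤m+n _ (3 * k * suc s + 4 * s + 3)) (ℕ.≤-reflexive (identity k s))
  where
    identity : ∀ k s → suc (suc s + suc s + 4 * (suc s * (suc (suc k) * 3))) + (3 * k * suc s + 4 * s + 3)
                       ≡ 15 * suc (suc k) * suc s
    identity = solve-∀

room-for-remainder : ∀ {L k dm S ds} → suc L ≤ k → S ≤ L * (dm + 3) → k * (dm + 3) ≤ ds → S + dm ≤ ds
room-for-remainder {L} {k} {dm} {S} {ds} L<k S≤ k≤ds = begin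
  S + dm                  ≤⟨ ℕ.+-mono-≤ S≤ (ℕ.m≤m+n dm 3) ⟩
  L * (dm + 3) + (dm + 3) ≡⟨ ℕ.+-comm (L * (dm + 3)) (dm + 3) ⟩
  suc L * (dm + 3)        ≤⟨ ℕ.*-monoˡ-≤ (dm + 3) L<k ⟩
  k * (dm + 3)            ≤⟨ k≤ds ⟩
  ds                      ∎
  where open ℕ.≤-Reasoning

module _ {k : ℕ} (F : Graph k) where

  Adj⇒≢ : ∀ {u v} → Adj F u v → u ≢ v
  Adj⇒≢ {u} uu refl = subst T (irrefl F u) uu

  private
    another : 2 ≤ k → (u : Fin k) → Σ (Fin k) (u ≢_)
    another (s≤s (s≤s _)) fzero    = fsuc fzero , λ ()
    another (s≤s (s≤s _)) (fsuc _) = fzero , λ ()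

    first-step : ∀ {u v d} → Path F u v d → u ≢ v → Σ (Fin k) (Adj F u)
    first-step {d = zero}  P u≢v = ⊥-elim (u≢v (trans (≡.sym (start P)) (end P)))
    first-step {d = suc d} P u≢v = vert P (fsuc fzero) , subst (λ w → Adj F w (vert P (fsuc fzero))) (start P) (step P fzero)

  Connected⇒neighbour : Connected F → 2 ≤ k → ∀ u → Σ (Fin k) (Adj F u)
  Connected⇒neighbour connected 2≤k u =
    let v , u≢v = another 2≤k u in first-step (proj₂ (connected u v)) u≢v

  record Edge : Set where
    field
      from to  : Fin k
      adjacent : Adj F from to

module _ {n : ℕ} {G : Graph n} where

  reverseLink : ∀ {A B} → ShortLink G A B → ShortLink G B A
  reverseLink L = record { src = tgt L ; tgt = src L ; len = len L ; srcIn = tgtIn L ; tgtIn = srcIn L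
                  ; len≤3 = len≤3 L ; path = reverse (path L) }

-- Links are given only for u < v; they are oriented along an arbitrary edge by reversing.
module Oriented {n k t : ℕ} {G : Graph n} (X : Fin k → VSet n) (F : Graph k)
  (𝒫 : (u v : Fin k) → u < v → Adj F u v → Fin t → ShortLink G (X u) (X v)) where

  open Edge

  OnSomeLink : Fin n → Set
  OnSomeLink w = Σ (Fin k) λ u → Σ (Fin k) λ v → Σ (u < v) λ lt → Σ (Adj F u v) λ e →
                 Σ (Fin t) λ a → OnLink (𝒫 u v lt e a) w

  link : (E : Edge F) → Fin t → ShortLink G (X (from E)) (X (to E))
  link E a with <-cmp (from E) (to E)
  ... | tri< lt _ _ = 𝒫 _ _ lt (adjacent E) a
  ... | tri≈ _ u≡v _ = ⊥-elim (Adj⇒≢ F (adjacent E) u≡v)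
  ... | tri> _ _ gt = reverseLink (𝒫 _ _ gt (Adj-sym F (adjacent E)) a)

  onLink⇒onSomeLink : ∀ E a {w} → OnLink (link E a) w → OnSomeLink w
  onLink⇒onSomeLink E a w∈L with <-cmp (from E) (to E)
  ... | tri< lt _ _ = _ , _ , lt , adjacent E , a , w∈L
  ... | tri≈ _ u≡v _ = ⊥-elim (Adj⇒≢ F (adjacent E) u≡v)
  ... | tri> _ _ gt = _ , _ , gt , Adj-sym F (adjacent E) , a , onPath-reverse⁻ (path (𝒫 _ _ gt _ a)) w∈L

  link-interiorIn : ∀ {S} → (∀ u v (lt : u < v) (e : Adj F u v) a → LinkInteriorIn (𝒫 u v lt e a) S) →
                    ∀ E a → LinkInteriorIn (link E a) S
  link-interiorIn 𝒫-in E a w w∈L° with <-cmp (from E) (to E)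
  ... | tri< lt _ _ = 𝒫-in _ _ lt (adjacent E) a w w∈L°
  ... | tri≈ _ u≡v _ = ⊥-elim (Adj⇒≢ F (adjacent E) u≡v)
  ... | tri> _ _ gt = 𝒫-in _ _ gt _ a w (interior-reverse⁻ (path (𝒫 _ _ gt _ a)) w∈L°)

  link-disjoint : (∀ u v (lt : u < v) (e : Adj F u v) a b → a ≢ b → LinkDisjoint (𝒫 u v lt e a) (𝒫 u v lt e b)) →
                  ∀ E {a b} → a ≢ b → LinkDisjoint (link E a) (link E b)
  link-disjoint 𝒫-disjoint E {a} {b} a≢b w w∈La w∈Lb with <-cmp (from E) (to E)
  ... | tri< lt _ _ = 𝒫-disjoint _ _ lt (adjacent E) a b a≢b w w∈La w∈Lb
  ... | tri≈ _ u≡v _ = ⊥-elim (Adj⇒≢ F (adjacent E) u≡v)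
  ... | tri> _ _ gt = 𝒫-disjoint _ _ gt _ a b a≢b w
                        (onPath-reverse⁻ (path (𝒫 _ _ gt _ a)) w∈La) (onPath-reverse⁻ (path (𝒫 _ _ gt _ b)) w∈Lb)

LinkedSystem-mono : ∀ {n} {G : Graph n} {s dm dp dm′ dp′} {X X′ W W′ : VSet n} →
  (∀ {v} → X′ v → X v) → (∀ {v} → W v → W′ v) → dm ≤ dm′ → dp′ ≤ dp →
  LinkedSystem G s dm dp X W → LinkedSystem G s dm′ dp′ X′ W′
LinkedSystem-mono X′⊆X W⊆W′ dm≤dm′ dp′≤dp linked xs ys xs∈X′ ys∈X′ xy-injective ds ds-bounds =
  let P , P-interior , P-disjoint = linked xs ys (X′⊆X ∘ xs∈X′) (X′⊆X ∘ ys∈X′) xy-injective ds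
        (λ i → ℕ.≤-trans dm≤dm′ (proj₁ (ds-bounds i)) , ℕ.≤-trans (proj₂ (ds-bounds i)) dp′≤dp)
  in P , (λ i v v° → W⊆W′ (P-interior i v v°)) , P-disjoint

Fin-≤1-unique : ∀ {k} → ¬ 2 ≤ k → (i j : Fin k) → i ≡ j
Fin-≤1-unique {suc zero}    _   fzero fzero = refl
Fin-≤1-unique {suc (suc k)} k≱2 _     _     = ⊥-elim (k≱2 (s≤s (s≤s z≤n)))

module Construction {n : ℕ} (G : Graph n) {k s dm dp t : ℕ}
  (X W : Fin k → VSet n)
  (linked : ∀ j → LinkedSystem G s dm dp (X j) (W j))
  (pieces-disjoint : ∀ i j → i ≢ j → ∀ v → (X i v ⊎ W i v) → (X j v ⊎ W j v) → ⊥)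
  (F : Graph k) (connected : Connected F)
  (𝒫 : (u v : Fin k) → u < v → Adj F u v → Fin t → ShortLink G (X u) (X v))
  (𝒫-outside : ∀ u v (lt : u < v) (e : Adj F u v) (a : Fin t) →
      LinkInteriorIn (𝒫 u v lt e a) (λ w → ⋃ (λ i x → X i x ⊎ W i x) w → ⊥))
  (𝒫-disjoint : ∀ u v (lt : u < v) (e : Adj F u v) (a b : Fin t) → a ≢ b →
      LinkDisjoint (𝒫 u v lt e a) (𝒫 u v lt e b))
  (2≤k : 2 ≤ k) (1≤s : 1 ≤ s) (enough : 15 * k * s ≤ t)
  (xs ys : Fin s → Fin n) (xs∈X : ∀ i → ⋃ X (xs i)) (ys∈X : ∀ i → ⋃ X (ys i))
  (xy-injective : Injective _≡_ _≡_ [ xs , ys ])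
  (ds : Fin s → ℕ) (ds-bounds : ∀ i → k * (dm + 3) ≤ ds i × ds i ≤ dp)
  where

  import Data.List as List
  open import Data.List.Properties using (length-tabulate; length-++)
  open import Data.List.Membership.Propositional using (_∈_)
  open import Data.List.Membership.Propositional.Properties using (∈-tabulate⁺; ∈-tabulate⁻; ∈-++⁺ˡ; ∈-++⁺ʳ)

  open Oriented X F 𝒫
  open Edge

  routeLength : Fin s → ℕ
  routeLength i = proj₁ (connected (proj₁ (xs∈X i)) (proj₁ (ys∈X i)))

  route : ∀ i → Path F (proj₁ (xs∈X i)) (proj₁ (ys∈X i)) (routeLength i)
  route i = proj₂ (connected (proj₁ (xs∈X i)) (proj₁ (ys∈X i)))

  stop : ∀ i → Fin (suc (routeLength i)) → Fin k
  stop i = vert (route i)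

  routeLength<k : ∀ i → suc (routeLength i) ≤ k
  routeLength<k i = Fin.injective⇒≤ (inj (route i))

  routeStep : ∀ i → Fin (routeLength i) → Fin k
  routeStep i e = inject≤ e (ℕ.≤-trans (ℕ.n≤1+n _) (routeLength<k i))

  routeEdge : ∀ i → Fin (routeLength i) → Edge F
  routeEdge i e = record { from = stop i (inject₁ e) ; to = stop i (fsuc e) ; adjacent = step (route i) e }

  spareEdge : Fin k → Edge F
  spareEdge j = record { from = j ; to = proj₁ (neighbour j) ; adjacent = proj₂ (neighbour j) }
    where
      neighbour : ∀ j → Σ (Fin k) (Adj F j)
      neighbour = Connected⇒neighbour F connected 2≤k

  -- Slot (i , p , 0) carries the p-th edge of the route of pair i (a spare edge at piece p once
  -- p exceeds the route); the sources of the spare slots (i , j , 1) and (i , j , 2) are the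
  -- dummy endpoints of pair i in a piece j its route avoids.
  Slot : Set
  Slot = Fin s × Fin k × Fin 3

  pattern routeSlot i p = i , p , fzero
  pattern entrySlot i j = i , j , fsuc fzero
  pattern exitSlot  i j = i , j , fsuc (fsuc fzero)

  stepSlot : ∀ i → Fin (routeLength i) → Slot
  stepSlot i e = routeSlot i (routeStep i e)

  slotEdge : Slot → Edge F
  slotEdge (routeSlot i p) with toℕ p ℕ.<? routeLength i
  ... | yes p<L = routeEdge i (fromℕ< p<L)
  ... | no _    = spareEdge p
  slotEdge (entrySlot i j) = spareEdge j
  slotEdge (exitSlot  i j) = spareEdge j

  slotEdge-route : ∀ i e → slotEdge (stepSlot i e) ≡ routeEdge i e
  slotEdge-route i e with toℕ (routeStep i e) ℕ.<? routeLength i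
  ... | yes p<L = cong (routeEdge i) (Fin.toℕ-injective (trans (Fin.toℕ-fromℕ< p<L) (Fin.toℕ-inject≤ e _)))
  ... | no p≮L  = ⊥-elim (p≮L (subst (ℕ._< routeLength i) (≡.sym (Fin.toℕ-inject≤ e _)) (Fin.toℕ<n e)))

  routeStep-injective : ∀ i {e e′} → routeStep i e ≡ routeStep i e′ → e ≡ e′
  routeStep-injective i = Fin.inject≤-injective _ _ _ _

  code : Slot → Fin (s * (k * 3))
  code (i , j , g) = combine i (combine j g)

  decode : Fin (s * (k * 3)) → Slot
  decode r = let i , r′ = remQuot {s} (k * 3) r in i , remQuot {k} 3 r′

  decode-code : ∀ x → decode (code x) ≡ x
  decode-code (i , j , g) = trans (cong (λ (i , r′) → i , remQuot {k} 3 r′) (Fin.remQuot-combine i (combine j g)))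
                                  (cong (i ,_) (Fin.remQuot-combine j g))

  vertices : ∀ {A B} → ShortLink G A B → List (Fin n)
  vertices L = List.tabulate (vert (path L))

  onLink⇒∈vertices : ∀ {A B w} (L : ShortLink G A B) → OnLink L w → w ∈ vertices L
  onLink⇒∈vertices L (i , refl) = ∈-tabulate⁺ {f = vert (path L)} i

  ∈vertices⇒onLink : ∀ {A B w} (L : ShortLink G A B) → w ∈ vertices L → OnLink L w
  ∈vertices⇒onLink L w∈L = let i , w≡ = ∈-tabulate⁻ {f = vert (path L)} w∈L in i , ≡.sym w≡

  endpoint : Fin s ⊎ Fin s → Fin n
  endpoint = [ xs , ys ]

  terminals : List (Fin n)
  terminals = List.tabulate xs List.++ List.tabulate ys

  ∈terminals : ∀ a → endpoint a ∈ terminals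
  ∈terminals (inj₁ i) = ∈-++⁺ˡ (∈-tabulate⁺ {f = xs} i)
  ∈terminals (inj₂ i) = ∈-++⁺ʳ (List.tabulate xs) (∈-tabulate⁺ {f = ys} i)

  length-vertices : ∀ {A B} (L : ShortLink G A B) → List.length (vertices L) ≤ 4
  length-vertices L = subst (_≤ 4) (≡.sym (length-tabulate (vert (path L)))) (s≤s (len≤3 L))

  length-terminals : List.length terminals ≡ s + s
  length-terminals = trans (length-++ (List.tabulate xs)) (≡.cong₂ _+_ (length-tabulate xs) (length-tabulate ys))

  opaque
    allocation : Σ (Slot → Fin t) λ c →
       (∀ x → Disjointᴸ (vertices (link (slotEdge x) (c x))) terminals) ×
       (∀ {x y} → x ≢ y → Disjointᴸ (vertices (link (slotEdge x) (c x))) (vertices (link (slotEdge y) (c y))))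
    allocation = choice-avoiding-retract _≟_ code decode decode-code terminals (λ x a → vertices (link (slotEdge x) a))
      (λ x a → length-vertices (link (slotEdge x) a))
      (λ x {a} {b} a≢b (w∈a , w∈b) → link-disjoint 𝒫-disjoint (slotEdge x) a≢b _
         (∈vertices⇒onLink (link (slotEdge x) a) w∈a) (∈vertices⇒onLink (link (slotEdge x) b) w∈b))
      (subst (λ l → l + 4 * (s * (k * 3)) ℕ.< t) (≡.sym length-terminals) (ℕ.<-≤-trans (slots-fit 2≤k 1≤s) enough))

  chosen : (x : Slot) → ShortLink G (X (from (slotEdge x))) (X (to (slotEdge x)))
  chosen x = link (slotEdge x) (proj₁ allocation x)

  Outside : Fin n → Set
  Outside w = ⋃ (λ j v → X j v ⊎ W j v) w → ⊥

  chosen-avoids-endpoints : ∀ x a → OnLink (chosen x) (endpoint a) → ⊥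
  chosen-avoids-endpoints x a on = proj₁ (proj₂ allocation) x (onLink⇒∈vertices (chosen x) on , ∈terminals a)

  chosen-disjoint : ∀ {x y} → x ≢ y → Disjoint (path (chosen x)) (path (chosen y))
  chosen-disjoint {x} {y} x≢y w w∈x w∈y =
    proj₂ (proj₂ allocation) x≢y (onLink⇒∈vertices (chosen x) w∈x , onLink⇒∈vertices (chosen y) w∈y)

  chosen-outside : ∀ x → LinkInteriorIn (chosen x) Outside
  chosen-outside x = link-interiorIn 𝒫-outside (slotEdge x) (proj₁ allocation x)

  chosen-onSomeLink : ∀ x {w} → OnLink (chosen x) w → OnSomeLink w
  chosen-onSomeLink x = onLink⇒onSomeLink (slotEdge x) (proj₁ allocation x)

  chosen-src≢tgt : ∀ x → src (chosen x) ≢ tgt (chosen x)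
  chosen-src≢tgt x same = pieces-disjoint _ _ (Adj⇒≢ F (adjacent (slotEdge x))) (src (chosen x))
    (inj₁ (srcIn (chosen x))) (inj₁ (subst (X (to (slotEdge x))) (≡.sym same) (tgtIn (chosen x))))

  data End : Set where
    source target : End

  data Terminal : Set where
    pairEnd : Fin s ⊎ Fin s → Terminal
    linkEnd : Slot → End → Terminal

  terminal : Terminal → Fin n
  terminal (pairEnd a)          = endpoint a
  terminal (linkEnd x source) = src (chosen x)
  terminal (linkEnd x target) = tgt (chosen x)

  terminal-onLink : ∀ x e → OnLink (chosen x) (terminal (linkEnd x e))
  terminal-onLink x source = start∈ (path (chosen x))
  terminal-onLink x target = end∈ (path (chosen x))

  terminal-injective : Injective _≡_ _≡_ terminal
  terminal-injective {pairEnd a}   {pairEnd b}   same = cong pairEnd (xy-injective same)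
  terminal-injective {pairEnd a}   {linkEnd y e} same =
    ⊥-elim (chosen-avoids-endpoints y a (subst (OnLink (chosen y)) (≡.sym same) (terminal-onLink y e)))
  terminal-injective {linkEnd x e} {pairEnd b}   same =
    ⊥-elim (chosen-avoids-endpoints x b (subst (OnLink (chosen x)) same (terminal-onLink x e)))
  terminal-injective {linkEnd x e} {linkEnd y e′} same with ≡-dec _≟_ (≡-dec _≟_ _≟_) x y
  ... | no x≢y  = ⊥-elim (chosen-disjoint x≢y _ (terminal-onLink x e)
                                              (subst (OnLink (chosen y)) (≡.sym same) (terminal-onLink y e′)))
  ... | yes refl = cong (linkEnd x) (same-end e e′ same)
    where
      same-end : ∀ e e′ → terminal (linkEnd x e) ≡ terminal (linkEnd x e′) → e ≡ e′
      same-end source source _ = refl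
      same-end target target _ = refl
      same-end source target st = ⊥-elim (chosen-src≢tgt x st)
      same-end target source ts = ⊥-elim (chosen-src≢tgt x (≡.sym ts))

  -- The pair a terminal serves, and whether as the entry (inj₁) or exit (inj₂) of its segments.
  role : Terminal → Fin s ⊎ Fin s
  role (pairEnd a)                      = a
  role (linkEnd (i , _ , _) target)     = inj₁ i
  role (linkEnd (routeSlot i _) source) = inj₂ i
  role (linkEnd (entrySlot i _) source) = inj₁ i
  role (linkEnd (exitSlot i _) source)  = inj₂ i

  entryTerminal exitTerminal : ∀ i → Fin (suc (routeLength i)) → Terminal
  entryTerminal i fzero    = pairEnd (inj₁ i)
  entryTerminal i (fsuc e) = linkEnd (stepSlot i e) target
  exitTerminal i q with routeLength i ℕ.≟ toℕ q
  ... | yes _    = pairEnd (inj₂ i)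
  ... | no L≢q   = linkEnd (stepSlot i (lower₁ q L≢q)) source

  exitTerminal-last : ∀ i → exitTerminal i (fromℕ (routeLength i)) ≡ pairEnd (inj₂ i)
  exitTerminal-last i with routeLength i ℕ.≟ toℕ (fromℕ (routeLength i))
  ... | yes _  = refl
  ... | no L≢L = ⊥-elim (L≢L (≡.sym (Fin.toℕ-fromℕ (routeLength i))))

  exitTerminal-inject₁ : ∀ i e → exitTerminal i (inject₁ e) ≡ linkEnd (stepSlot i e) source
  exitTerminal-inject₁ i e with routeLength i ℕ.≟ toℕ (inject₁ e)
  ... | yes L≡e = ⊥-elim (ℕ.<-irrefl (≡.sym (trans L≡e (Fin.toℕ-inject₁ e))) (Fin.toℕ<n e))
  ... | no L≢e  = cong (λ e′ → linkEnd (stepSlot i e′) source) (Fin.lower₁-inject₁′ e L≢e)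

  role-entryTerminal : ∀ i q → role (entryTerminal i q) ≡ inj₁ i
  role-entryTerminal i fzero    = refl
  role-entryTerminal i (fsuc e) = refl

  role-exitTerminal : ∀ i q → role (exitTerminal i q) ≡ inj₂ i
  role-exitTerminal i q with routeLength i ℕ.≟ toℕ q
  ... | yes _ = refl
  ... | no _  = refl

  entryTerminal∈X : ∀ i q → X (stop i q) (terminal (entryTerminal i q))
  entryTerminal∈X i fzero    = subst (λ j → X j (xs i)) (≡.sym (start (route i))) (proj₂ (xs∈X i))
  entryTerminal∈X i (fsuc e) = subst (λ E → X (to E) (tgt (chosen (stepSlot i e)))) (slotEdge-route i e)
                                 (tgtIn (chosen (stepSlot i e)))

  exitTerminal∈X : ∀ i q → X (stop i q) (terminal (exitTerminal i q))
  exitTerminal∈X i q with routeLength i ℕ.≟ toℕ q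
  ... | yes L≡q = subst (λ q → X (stop i q) (ys i)) (Fin.toℕ-injective (trans (Fin.toℕ-fromℕ _) L≡q))
                    (subst (λ j → X j (ys i)) (≡.sym (end (route i))) (proj₂ (ys∈X i)))
  ... | no L≢q  = subst (λ q → X (stop i q) (src (chosen x))) (Fin.inject₁-lower₁ q L≢q)
                    (subst (λ E → X (from E) (src (chosen x))) (slotEdge-route i (lower₁ q L≢q)) (srcIn (chosen x)))
    where x = stepSlot i (lower₁ q L≢q)

  routeLinkLength : ∀ i → Fin (routeLength i) → ℕ
  routeLinkLength i e = len (chosen (stepSlot i e))

  linksAndSegments : Fin s → ℕ
  linksAndSegments i = ∑[ e < routeLength i ] (routeLinkLength i e + dm)

  remainder : Fin s → ℕ
  remainder i = ds i ∸ linksAndSegments i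

  room : ∀ i → linksAndSegments i + dm ≤ ds i
  room i = room-for-remainder (routeLength<k i)
    (sum-≤ (λ e → routeLinkLength i e + dm)
      (λ e → subst (_≤ dm + 3) (ℕ.+-comm dm _) (ℕ.+-monoʳ-≤ dm (len≤3 (chosen (stepSlot i e))))))
    (proj₁ (ds-bounds i))

  dm≤remainder : ∀ i → dm ≤ remainder i
  dm≤remainder i = ℕ.m+n≤o⇒m≤o∸n dm (subst (_≤ ds i) (ℕ.+-comm _ dm) (room i))

  remainder≤dp : ∀ i → remainder i ≤ dp
  remainder≤dp i = ℕ.≤-trans (ℕ.m∸n≤m (ds i) (linksAndSegments i)) (proj₂ (ds-bounds i))

  remainder-total : ∀ i → remainder i + linksAndSegments i ≡ ds i
  remainder-total i = ℕ.m∸n+n≡m (ℕ.m+n≤o⇒m≤o (linksAndSegments i) (room i))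

  dm≤dp : dm ≤ dp
  dm≤dp = ℕ.≤-trans (dm≤remainder (fromℕ< 1≤s)) (remainder≤dp (fromℕ< 1≤s))

  segmentLength : ∀ i → Fin (suc (routeLength i)) → ℕ
  segmentLength i fzero    = remainder i
  segmentLength i (fsuc _) = dm

  segmentLength-bounds : ∀ i q → dm ≤ segmentLength i q × segmentLength i q ≤ dp
  segmentLength-bounds i fzero    = dm≤remainder i , remainder≤dp i
  segmentLength-bounds i (fsuc _) = ℕ.≤-refl , dm≤dp

  atVisit : ∀ {A : Set} i j → (Fin (suc (routeLength i)) → A) → A → A
  atVisit i j f default with Fin.any? (λ q → stop i q ≟ j)
  ... | yes (q , _) = f q
  ... | no _        = default

  atVisit-elim : ∀ {A : Set} (P : Fin k → A → Set) i j f default →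
                 (∀ q → P (stop i q) (f q)) → P j default → P j (atVisit {A} i j f default)
  atVisit-elim P i j f default P-visit P-default with Fin.any? (λ q → stop i q ≟ j)
  ... | yes (q , refl) = P-visit q
  ... | no _           = P-default

  atVisit-stop : ∀ {A : Set} i q f (default : A) → atVisit i (stop i q) f default ≡ f q
  atVisit-stop i q f default with Fin.any? (λ q′ → stop i q′ ≟ stop i q)
  ... | yes (q′ , same) = cong f (inj (route i) same)
  ... | no never        = ⊥-elim (never (q , refl))

  localEntry localExit : Fin k → Fin s → Terminal
  localEntry j i = atVisit i j (entryTerminal i) (linkEnd (entrySlot i j) source)
  localExit  j i = atVisit i j (exitTerminal i) (linkEnd (exitSlot i j) source)

  localLength : Fin k → Fin s → ℕ
  localLength j i = atVisit i j (segmentLength i) dm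

  localEntry∈X : ∀ j i → X j (terminal (localEntry j i))
  localEntry∈X j i = atVisit-elim (λ j T → X j (terminal T)) i j _ _ (entryTerminal∈X i) (srcIn (chosen (entrySlot i j)))

  localExit∈X : ∀ j i → X j (terminal (localExit j i))
  localExit∈X j i = atVisit-elim (λ j T → X j (terminal T)) i j _ _ (exitTerminal∈X i) (srcIn (chosen (exitSlot i j)))

  localLength-bounds : ∀ j i → dm ≤ localLength j i × localLength j i ≤ dp
  localLength-bounds j i = atVisit-elim (λ _ d → dm ≤ d × d ≤ dp) i j _ _ (segmentLength-bounds i) (ℕ.≤-refl , dm≤dp)

  localEnd : Fin k → Fin s ⊎ Fin s → Terminal
  localEnd j = [ localEntry j , localExit j ]

  role-localEnd : ∀ j a → role (localEnd j a) ≡ a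
  role-localEnd j (inj₁ i) = atVisit-elim (λ _ T → role T ≡ inj₁ i) i j _ _ (role-entryTerminal i) refl
  role-localEnd j (inj₂ i) = atVisit-elim (λ _ T → role T ≡ inj₂ i) i j _ _ (role-exitTerminal i) refl

  local-injective : ∀ j → Injective _≡_ _≡_ [ terminal ∘ localEntry j , terminal ∘ localExit j ]
  local-injective j {a} {b} same = begin
    a                       ≡⟨ ≡.sym (role-localEnd j a) ⟩
    role (localEnd j a)     ≡⟨ cong role (terminal-injective {localEnd j a} {localEnd j b} same′) ⟩
    role (localEnd j b)     ≡⟨ role-localEnd j b ⟩
    b                       ∎
    where
      open ≡.≡-Reasoning
      same′ : terminal (localEnd j a) ≡ terminal (localEnd j b)
      same′ = trans ([,]-∘ terminal a) (trans same (≡.sym ([,]-∘ terminal b)))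

  localPaths : ∀ j → Σ (∀ i → Path G (terminal (localEntry j i)) (terminal (localExit j i)) (localLength j i)) λ P →
                     (∀ i → InteriorIn (P i) (W j)) × (∀ i i′ → i ≢ i′ → Disjoint (P i) (P i′))
  localPaths j = linked j (terminal ∘ localEntry j) (terminal ∘ localExit j) (localEntry∈X j) (localExit∈X j)
                   (local-injective j) (localLength j) (localLength-bounds j)

  localPath : ∀ j i → Path G (terminal (localEntry j i)) (terminal (localExit j i)) (localLength j i)
  localPath j = proj₁ (localPaths j)

  localPath⊆piece : ∀ j i {v} → OnPath (localPath j i) v → X j v ⊎ W j v
  localPath⊆piece j i v∈P with endpoint⊎interior (localPath j i) v∈P
  ... | inj₁ refl        = inj₁ (localEntry∈X j i)
  ... | inj₂ (inj₁ refl) = inj₁ (localExit∈X j i)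
  ... | inj₂ (inj₂ v∈P°) = inj₂ (proj₁ (proj₂ (localPaths j)) i _ v∈P°)

  localPaths-disjoint : ∀ j j′ {i i′} → i ≢ i′ → Disjoint (localPath j i) (localPath j′ i′)
  localPaths-disjoint j j′ {i} {i′} i≢i′ v v∈P v∈P′ with j ≟ j′
  ... | yes refl = proj₂ (proj₂ (localPaths j)) i i′ i≢i′ v v∈P v∈P′
  ... | no j≢j′  = pieces-disjoint j j′ j≢j′ v (localPath⊆piece j i v∈P) (localPath⊆piece j′ i′ v∈P′)

  entry-at : ∀ i q → localEntry (stop i q) i ≡ entryTerminal i q
  entry-at i q = atVisit-stop i q (entryTerminal i) (linkEnd (entrySlot i (stop i q)) source)

  exit-at : ∀ i q → localExit (stop i q) i ≡ exitTerminal i q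
  exit-at i q = atVisit-stop i q (exitTerminal i) (linkEnd (exitSlot i (stop i q)) source)

  chainSegment : ∀ i q → Path G (terminal (entryTerminal i q)) (terminal (exitTerminal i q)) (segmentLength i q)
  chainSegment i q = cast (cong terminal (entry-at i q)) (cong terminal (exit-at i q))
                       (atVisit-stop i q (segmentLength i) dm) (localPath (stop i q) i)

  onPath-chainSegment⁻ : ∀ i q {v} → OnPath (chainSegment i q) v → OnPath (localPath (stop i q) i) v
  onPath-chainSegment⁻ i q = onPath-cast⁻ (cong terminal (entry-at i q)) (cong terminal (exit-at i q))
                               (atVisit-stop i q (segmentLength i) dm) (localPath (stop i q) i)

  routeLink : ∀ i e → ShortLink G (X (from (slotEdge (stepSlot i e)))) (X (to (slotEdge (stepSlot i e))))
  routeLink i e = chosen (stepSlot i e)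

  chainLink : ∀ i e → Path G (terminal (exitTerminal i (inject₁ e))) (terminal (entryTerminal i (fsuc e)))
                              (routeLinkLength i e)
  chainLink i e = cast (≡.sym (cong terminal (exitTerminal-inject₁ i e))) refl refl (path (routeLink i e))

  onPath-chainLink⁻ : ∀ i e {v} → OnPath (chainLink i e) v → OnLink (routeLink i e) v
  onPath-chainLink⁻ i e = onPath-cast⁻ (≡.sym (cong terminal (exitTerminal-inject₁ i e))) refl refl (path (routeLink i e))

  chainLink-avoids-segment : ∀ i e i′ q {v} → Interior (chainLink i e) v → OnPath (chainSegment i′ q) v → ⊥
  chainLink-avoids-segment i e i′ q v° v∈seg =
    chosen-outside (stepSlot i e) _
      (interior-cast⁻ (≡.sym (cong terminal (exitTerminal-inject₁ i e))) refl refl (path (routeLink i e)) v°)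
      (stop i′ q , localPath⊆piece (stop i′ q) i′ (onPath-chainSegment⁻ i′ q v∈seg))

  pairChain : ∀ i → Chain {G = G} (routeLength i)
  pairChain i = record
    { entry = terminal ∘ entryTerminal i
    ; exit  = terminal ∘ exitTerminal i
    ; segmentLength = segmentLength i
    ; linkLength    = routeLinkLength i
    ; segment = chainSegment i
    ; link    = chainLink i
    ; segments-disjoint = λ {q} {q′} q≢q′ v v∈S v∈S′ →
        pieces-disjoint _ _ (q≢q′ ∘ inj (route i)) v
          (localPath⊆piece _ i (onPath-chainSegment⁻ i q v∈S)) (localPath⊆piece _ i (onPath-chainSegment⁻ i q′ v∈S′))
    ; links-disjoint = λ {e} {e′} e≢e′ v v∈L v∈L′ →
        chosen-disjoint {stepSlot i e} {stepSlot i e′}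
          (λ same → e≢e′ (routeStep-injective i (cong (proj₁ ∘ proj₂) same))) v
          (onPath-chainLink⁻ i e v∈L) (onPath-chainLink⁻ i e′ v∈L′)
    ; link-avoids-segments = λ e q → chainLink-avoids-segment i e i q
    }

  pathLength : ∀ i → chainLength (pairChain i) ≡ ds i
  pathLength i = trans (chainLength-sum (pairChain i)) (remainder-total i)

  pairPath : ∀ i → Path G (xs i) (ys i) (ds i)
  pairPath i = cast refl (cong terminal (exitTerminal-last i)) (pathLength i) (glue (pairChain i))

  pairPath-covered : ∀ i {v} → OnPath (pairPath i) v → Covered (pairChain i) v
  pairPath-covered i = glue-covered (pairChain i) ∘ onPath-cast⁻ refl (cong terminal (exitTerminal-last i)) (pathLength i) _

  W′ : VSet n
  W′ w = ⋃ W w ⊎ OnSomeLink w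

  linkEnd∈W′ : ∀ x e {v} → v ≡ terminal (linkEnd x e) → W′ v
  linkEnd∈W′ x e refl = inj₂ (chosen-onSomeLink x (terminal-onLink x e))

  entryTerminal∈W′ : ∀ i q {v} → v ≡ terminal (entryTerminal i q) → v ≢ xs i → W′ v
  entryTerminal∈W′ i fzero    v≡xs v≢xs = ⊥-elim (v≢xs v≡xs)
  entryTerminal∈W′ i (fsuc e) v≡     _    = linkEnd∈W′ (stepSlot i e) target v≡

  exitTerminal∈W′ : ∀ i q {v} → v ≡ terminal (exitTerminal i q) → v ≢ ys i → W′ v
  exitTerminal∈W′ i q v≡ v≢ys with routeLength i ℕ.≟ toℕ q
  ... | yes _    = ⊥-elim (v≢ys v≡)
  ... | no L≢q   = linkEnd∈W′ (stepSlot i (lower₁ q L≢q)) source v≡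

  pairPath-interior : ∀ i → InteriorIn (pairPath i) W′
  pairPath-interior i v v° with pairPath-covered i (interior⇒onPath (pairPath i) v°)
  ... | inj₂ (e , v∈L°) =
    inj₂ (chosen-onSomeLink (stepSlot i e) (onPath-chainLink⁻ i e (interior⇒onPath (chainLink i e) v∈L°)))
  ... | inj₁ (q , v∈S) with endpoint⊎interior (chainSegment i q) v∈S
  ...   | inj₁ v≡entry       = entryTerminal∈W′ i q v≡entry (interior-≢start (pairPath i) v°)
  ...   | inj₂ (inj₁ v≡exit) = exitTerminal∈W′ i q v≡exit (interior-≢end (pairPath i) v°)
  ...   | inj₂ (inj₂ v∈S°)   = inj₁ (stop i q , proj₁ (proj₂ (localPaths (stop i q))) i v
                                   (interior-cast⁻ (cong terminal (entry-at i q)) (cong terminal (exit-at i q))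
                                     (atVisit-stop i q (segmentLength i) dm) (localPath (stop i q) i) v∈S°))

  covered-disjoint : ∀ {i i′ v} → i ≢ i′ → Covered (pairChain i) v → Covered (pairChain i′) v → ⊥
  covered-disjoint {i} {i′} i≢i′ (inj₁ (q , v∈S)) (inj₁ (q′ , v∈S′)) =
    localPaths-disjoint (stop i q) (stop i′ q′) i≢i′ _
      (onPath-chainSegment⁻ i q v∈S) (onPath-chainSegment⁻ i′ q′ v∈S′)
  covered-disjoint {i} {i′} _ (inj₁ (q , v∈S)) (inj₂ (e , v∈L°)) = chainLink-avoids-segment i′ e i q v∈L° v∈S
  covered-disjoint {i} {i′} _ (inj₂ (e , v∈L°)) (inj₁ (q , v∈S)) = chainLink-avoids-segment i e i′ q v∈L° v∈S
  covered-disjoint {i} {i′} i≢i′ (inj₂ (e , v∈L°)) (inj₂ (e′ , v∈L′°)) =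
    chosen-disjoint {stepSlot i e} {stepSlot i′ e′} (i≢i′ ∘ cong proj₁) _
      (onPath-chainLink⁻ i e (interior⇒onPath (chainLink i e) v∈L°))
      (onPath-chainLink⁻ i′ e′ (interior⇒onPath (chainLink i′ e′) v∈L′°))

  pairPaths-disjoint : ∀ i i′ → i ≢ i′ → Disjoint (pairPath i) (pairPath i′)
  pairPaths-disjoint i i′ i≢i′ v v∈P v∈P′ =
    covered-disjoint i≢i′ (pairPath-covered i v∈P) (pairPath-covered i′ v∈P′)

lemma4p13 : ∀ {n : ℕ} (G : Graph n) (k s dm dp : ℕ) →
    1 ≤ k → 1 ≤ s → 1 ≤ dm → 1 ≤ dp →
    (X W : Fin k → VSet n) →
    (∀ i → LinkedSystem G s dm dp (X i) (W i)) →
    (∀ i j → i ≢ j → ∀ v → (X i v ⊎ W i v) → (X j v ⊎ W j v) → ⊥) →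
    (F : Graph k) → Connected F →
    (t : ℕ) → 15 * k * s ≤ t →
    (𝒫 : (u v : Fin k) → u < v → Adj F u v → Fin t → ShortLink G (X u) (X v)) →
    (∀ u v (lt : u < v) (e : Adj F u v) (a : Fin t) →
      LinkInteriorIn (𝒫 u v lt e a) (λ w → ⋃ (λ i x → X i x ⊎ W i x) w → ⊥)) →
    (∀ u v (lt : u < v) (e : Adj F u v) (a b : Fin t) → a ≢ b →
      LinkDisjoint (𝒫 u v lt e a) (𝒫 u v lt e b)) →
    LinkedSystem G s (k * (dm + 3)) dp (⋃ X)
      (λ w → ⋃ W w ⊎
        Σ (Fin k) λ u → Σ (Fin k) λ v → Σ (u < v) λ lt → Σ (Adj F u v) λ e →
          Σ (Fin t) λ a → OnLink (𝒫 u v lt e a) w)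
lemma4p13 G k s dm dp 1≤k 1≤s _ _ X W linked pieces-disjoint F connected t enough 𝒫 𝒫-outside 𝒫-disjoint
  with 2 ℕ.≤? k
... | yes 2≤k = λ xs ys xs∈X ys∈X xy-injective ds ds-bounds →
  let open Construction G X W linked pieces-disjoint F connected 𝒫 𝒫-outside 𝒫-disjoint 2≤k 1≤s enough
                        xs ys xs∈X ys∈X xy-injective ds ds-bounds
  in pairPath , pairPath-interior , pairPaths-disjoint
... | no k≱2 = LinkedSystem-mono {X = X only} {X′ = ⋃ X}
                 (λ (j , v∈X) → subst (λ j → X j _) (Fin-≤1-unique k≱2 j only) v∈X) (λ v∈W → inj₁ (only , v∈W))
                 dm≤k[dm+3] ℕ.≤-refl (linked only)
  where
    only : Fin k
    only = fromℕ< 1≤k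
    dm≤k[dm+3] : dm ≤ k * (dm + 3)
    dm≤k[dm+3] = ℕ.≤-trans (ℕ.m≤m+n dm 3)
                   (subst (_≤ k * (dm + 3)) (ℕ.*-identityˡ (dm + 3)) (ℕ.*-monoˡ-≤ (dm + 3) 1≤k))
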